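{- Let $\mathfrak{M}=(T,<,I,V)$ be a model, $(t,\pi)$ a couple of $\mathfrak{M}$ and $\varphi$ a formula of the language with operators $\neg,\wedge,G,H,L$. Then: (1) $\mathfrak{M},(t,\pi)\models G\varphi$ iff for all couples $(s,\rho)$ of $\mathfrak{M}$ with $(t,\pi)\prec(s,\rho)$, $\mathfrak{M},(s,\rho)\models\varphi$; (2) $\mathfrak{M},(t,\pi)\models H\varphi$ iff for all couples $(s,\rho)$ of $\mathfrak{M}$ with $(s,\rho)\prec(t,\pi)$, $\mathfrak{M},(s,\rho)\models\varphi$; (3) $\mathfrak{M},(t,\pi)\models L\varphi$ iff for all couples $(s,\rho)$ of $\mathfrak{M}$ with $(t,\pi)\sim(s,\rho)$, $\mathfrak{M},(s,\rho)\models\varphi$.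
   Context: A tree is a pair $(T,<)$ with $<$ an irreflexive, transitive binary relation on $T$ that is downward linear: if $b<a$ and $c<a$ then $b=c$ or $b<c$ or $c<b$. A history is a $\subseteq$-maximal $<$-linearly ordered subset of $T$; $H_t$ denotes the set of histories containing $t$. An indistinguishability function assigns to each $t\in T$ an equivalence relation $I_t$ on $H_t$ such that for all $s,t\in T$ and $h,k\in H_t$, if $hI_tk$ and $s<t$ then $hI_sk$. $\Pi_t$ is the set of equivalence classes of $I_t$, and $[h]_{I_s}$ the $I_s$-class of $h\in H_s$. A frame is $(T,<,I)$ with $(T,<)$ a tree and $I$ an indistinguishability function; a model is $(T,<,I,V)$ with $(T,<,I)$ a frame and $V$ assigning to each propositional variable a subset of the set of couples $\bigcup_{t\in T}(\{t\}\times\Pi_t)$. Formulas are built from propositional variables with $\neg,\wedge$ and unary $G,H,L$. Satisfaction at a couple $(t,\pi)$: $p$ holds iff $(t,\pi)\in V(p)$; Boolean clauses as usual; $G\varphi$ holds iff for each $h\in\pi$ and each $s\in h$ with $t<s$, $\varphi$ holds at $(s,[h]_{I_s})$; $H\varphi$ holds iff for each $h\in\pi$ and each $s\in h$ with $s<t$, $\varphi$ holds at $(s,[h]_{I_s})$; $L\varphi$ holds iff for each $\rho\in\Pi_t$, $\varphi$ holds at $(t,\rho)$. On couples define $(t,\pi)\prec(s,\rho)$ iff $t<s$ and $\pi\supseteq\rho$; and $(t,\pi)\sim(s,\rho)$ iff $t=s$ (both $\pi,\rho\in\Pi_t$). -}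

module Defs where

open import Level using (0ℓ)
open import Data.Nat using (ℕ)
open import Data.Product using (_×_; _,_; Σ)
open import Data.Sum using (_⊎_)
open import Relation.Nullary using (¬_)
open import Relation.Unary using (Pred; _∈_; _⊆_)
open import Relation.Binary.PropositionalEquality using (_≡_)

record Tree : Set₁ where
  field
    T        : Set
    _<_      : T → T → Set
    <-irrefl : ∀ {a} → ¬ (a < a)
    <-trans  : ∀ {a b c} → a < b → b < c → a < c
    <-downLinear : ∀ {a b c} → b < a → c < a → b ≡ c ⊎ (b < c ⊎ c < b)

  Linear : Pred T 0ℓ → Set
  Linear X = ∀ x y → x ∈ X → y ∈ X → x ≡ y ⊎ (x < y ⊎ y < x)

  IsHistory : Pred T 0ℓ → Set₁
  IsHistory X = Linear X × (∀ (Y : Pred T 0ℓ) → Linear Y → X ⊆ Y → Y ⊆ X)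

  Hist : T → Pred T 0ℓ → Set₁
  Hist t h = IsHistory h × t ∈ h

record Frame : Set₂ where
  field
    tree : Tree
  open Tree tree public
  field
    I       : T → Pred T 0ℓ → Pred T 0ℓ → Set
    I-dom   : ∀ {t h k} → I t h k → Hist t h × Hist t k
    I-refl  : ∀ {t h} → Hist t h → I t h h
    I-sym   : ∀ {t h k} → I t h k → I t k h
    I-trans : ∀ {t h k l} → I t h k → I t k l → I t h l
    I-mono  : ∀ {s t h k} → I t h k → s < t → I s h k

data Form : Set where
  var : ℕ → Form
  ¬′  : Form → Form
  _∧′_ : Form → Form → Form
  G H L : Form → Form

-- A couple (t,π) with π ∈ Π_t is represented by
-- (t,h) with h ∈ H_t a representative of π = [h]_{I_t}; V p is a set of
-- couples, i.e. a predicate on representatives that is only defined on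
-- H_t and does not depend on the choice of representative.
record Model : Set₂ where
  field
    frame : Frame
  open Frame frame public
  field
    V      : ℕ → T → Pred T 0ℓ → Set₁
    V-dom  : ∀ {p t h} → V p t h → Hist t h
    V-resp : ∀ {p t h k} → I t h k → V p t h → V p t k

  ClassSub : T → Pred T 0ℓ → T → Pred T 0ℓ → Set₁
  ClassSub s k t h = ∀ (k′ : Pred T 0ℓ) → I s k k′ → I t h k′

  _≺_ : (Σ T λ _ → Pred T 0ℓ) → (Σ T λ _ → Pred T 0ℓ) → Set₁
  (t , h) ≺ (s , k) = t < s × ClassSub s k t h

  _∼_ : (Σ T λ _ → Pred T 0ℓ) → (Σ T λ _ → Pred T 0ℓ) → Set
  (t , h) ∼ (s , k) = t ≡ s

  _⊨_ : (Σ T λ _ → Pred T 0ℓ) → Form → Set₁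
  (t , h) ⊨ var p = V p t h
  (t , h) ⊨ ¬′ φ = ¬ ((t , h) ⊨ φ)
  (t , h) ⊨ (φ ∧′ ψ) = ((t , h) ⊨ φ) × ((t , h) ⊨ ψ)
  (t , h) ⊨ G φ = ∀ (h′ : Pred T 0ℓ) → I t h h′ → ∀ s → s ∈ h′ → t < s → (s , h′) ⊨ φ
  (t , h) ⊨ H φ = ∀ (h′ : Pred T 0ℓ) → I t h h′ → ∀ s → s ∈ h′ → s < t → (s , h′) ⊨ φ
  -- for each ρ ∈ Π_t, i.e. ρ = [k]_{I_t} with k ∈ H_t
  (t , h) ⊨ L φ = ∀ (k : Pred T 0ℓ) → Hist t k → (t , k) ⊨ φ

-- A couple (s,[k]) above (t,[h]) has k ∈ [h]_{I_t}, so G φ reaches it via the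
-- representative k; conversely, for h′ ∈ [h]_{I_t} and t < s, I-mono gives
-- [h′]_{I_s} ⊆ [h]_{I_t}. For H the representative may be taken to be h itself,
-- since histories are downward closed and truth does not depend on the
-- representative of a class.
module Submission where

open import Defs
open import Level using (0ℓ)
open import Data.Product using (_×_; _,_; proj₁; proj₂)
open import Data.Sum using (_⊎_; inj₁; inj₂)
open import Relation.Unary using (Pred; _∈_; _∪_; ｛_｝)
open import Relation.Binary.PropositionalEquality using (_≡_; refl; sym)
open import Function.Bundles using (_⇔_; mk⇔)

module TreeProperties (𝕋 : Tree) where
  open Tree 𝕋

  Comparable : T → T → Set
  Comparable x y = x ≡ y ⊎ (x < y ⊎ y < x)

  Comparable-sym : ∀ {x y} → Comparable x y → Comparable y x
  Comparable-sym (inj₁ x≡y)        = inj₁ (sym x≡y)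
  Comparable-sym (inj₂ (inj₁ x<y)) = inj₂ (inj₂ x<y)
  Comparable-sym (inj₂ (inj₂ y<x)) = inj₂ (inj₁ y<x)

  Linear-∪-｛｝ : ∀ {X s} → Linear X → (∀ x → x ∈ X → Comparable x s) →
                  Linear (X ∪ ｛ s ｝)
  Linear-∪-｛｝ lin cmp x y (inj₁ x∈X) (inj₁ y∈X) = lin x y x∈X y∈X
  Linear-∪-｛｝ lin cmp x _ (inj₁ x∈X) (inj₂ refl) = cmp x x∈X
  Linear-∪-｛｝ lin cmp _ y (inj₂ refl) (inj₁ y∈X) = Comparable-sym (cmp y y∈X)
  Linear-∪-｛｝ lin cmp _ _ (inj₂ refl) (inj₂ refl) = inj₁ refl

  Linear-comparable-predecessor : ∀ {X s t} → Linear X → t ∈ X → s < t →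
                                  ∀ x → x ∈ X → Comparable x s
  Linear-comparable-predecessor {s = s} {t} lin t∈X s<t x x∈X
    with lin x t x∈X t∈X
  ... | inj₁ refl        = inj₂ (inj₂ s<t)
  ... | inj₂ (inj₁ x<t)  = <-downLinear x<t s<t
  ... | inj₂ (inj₂ t<x)  = inj₂ (inj₂ (<-trans s<t t<x))

  IsHistory-downClosed : ∀ {h s t} → IsHistory h → t ∈ h → s < t → s ∈ h
  IsHistory-downClosed (lin , maximal) t∈h s<t =
    maximal _ (Linear-∪-｛｝ lin (Linear-comparable-predecessor lin t∈h s<t))
            inj₁ (inj₂ refl)

module ModelProperties (M : Model) where
  open Model M
  open TreeProperties tree

  ⊨-resp-I : ∀ {t h k} (φ : Form) → I t h k → (t , h) ⊨ φ → (t , k) ⊨ φ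
  ⊨-resp-I (var p)  hIk h⊨p                 = V-resp hIk h⊨p
  ⊨-resp-I (¬′ φ)   hIk h⊭φ k⊨φ             = h⊭φ (⊨-resp-I φ (I-sym hIk) k⊨φ)
  ⊨-resp-I (φ ∧′ ψ) hIk (h⊨φ , h⊨ψ)         = ⊨-resp-I φ hIk h⊨φ , ⊨-resp-I ψ hIk h⊨ψ
  ⊨-resp-I (G φ)    hIk h⊨Gφ h′ kIh′        = h⊨Gφ h′ (I-trans hIk kIh′)
  ⊨-resp-I (H φ)    hIk h⊨Hφ h′ kIh′        = h⊨Hφ h′ (I-trans hIk kIh′)
  ⊨-resp-I (L φ)    hIk h⊨Lφ                = h⊨Lφ

  ClassSub-earlier : ∀ {s t h} → s < t → ClassSub t h s h
  ClassSub-earlier s<t k hIk = I-mono hIk s<t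

  ClassSub-later : ∀ {s t h h′} → I t h h′ → t < s → ClassSub s h′ t h
  ClassSub-later hIh′ t<s k h′Ik = I-trans hIh′ (ClassSub-earlier t<s k h′Ik)

  ClassSub-earlier-representative : ∀ {s t h h′} → I t h h′ → s < t →
                                    ClassSub t h s h′
  ClassSub-earlier-representative hIh′ s<t k hIk =
    I-trans (I-sym (I-mono hIh′ s<t)) (ClassSub-earlier s<t k hIk)

  Hist-representative : ∀ {s t h h′} → I t h h′ → s ∈ h′ → Hist s h′
  Hist-representative hIh′ s∈h′ = proj₁ (proj₂ (I-dom hIh′)) , s∈h′

  G⇔successors : ∀ {t h} (φ : Form) →
    ((t , h) ⊨ G φ) ⇔ (∀ s k → Hist s k → (t , h) ≺ (s , k) → (s , k) ⊨ φ)
  G⇔successors φ = mk⇔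
    (λ h⊨Gφ s k s∈k (t<s , k⊆h) → h⊨Gφ k (k⊆h k (I-refl s∈k)) s (proj₂ s∈k) t<s)
    (λ succ⊨φ h′ hIh′ s s∈h′ t<s →
       succ⊨φ s h′ (Hist-representative hIh′ s∈h′) (t<s , ClassSub-later hIh′ t<s))

  H⇔predecessors : ∀ {t h} (φ : Form) → Hist t h →
    ((t , h) ⊨ H φ) ⇔ (∀ s k → Hist s k → (s , k) ≺ (t , h) → (s , k) ⊨ φ)
  H⇔predecessors {h = h} φ t∈h = mk⇔
    (λ h⊨Hφ s k _ (s<t , h⊆k) →
       ⊨-resp-I φ (I-sym (h⊆k h (I-refl t∈h)))
         (h⊨Hφ h (I-refl t∈h) s (IsHistory-downClosed (proj₁ t∈h) (proj₂ t∈h) s<t) s<t))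
    (λ pred⊨φ h′ hIh′ s s∈h′ s<t →
       pred⊨φ s h′ (Hist-representative hIh′ s∈h′)
         (s<t , ClassSub-earlier-representative hIh′ s<t))

  L⇔sameMoment : ∀ {t h} (φ : Form) →
    ((t , h) ⊨ L φ) ⇔ (∀ s k → Hist s k → (t , h) ∼ (s , k) → (s , k) ⊨ φ)
  L⇔sameMoment {t} φ = mk⇔
    (λ { h⊨Lφ .t k t∈k refl → h⊨Lφ k t∈k })
    (λ same⊨φ k t∈k → same⊨φ t k t∈k refl)

mainTheorem1 : (M : Model) → let open Model M in
    ∀ (t : T) (h : Pred T 0ℓ) → Hist t h → ∀ (φ : Form) →
    (((t , h) ⊨ G φ) ⇔ (∀ (s : T) (k : Pred T 0ℓ) → Hist s k → (t , h) ≺ (s , k) → (s , k) ⊨ φ))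
    × (((t , h) ⊨ H φ) ⇔ (∀ (s : T) (k : Pred T 0ℓ) → Hist s k → (s , k) ≺ (t , h) → (s , k) ⊨ φ))
    × (((t , h) ⊨ L φ) ⇔ (∀ (s : T) (k : Pred T 0ℓ) → Hist s k → (t , h) ∼ (s , k) → (s , k) ⊨ φ))
mainTheorem1 M t h t∈h φ = G⇔successors {t} {h} φ , H⇔predecessors φ t∈h , L⇔sameMoment {t} {h} φ
  where open ModelProperties M
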